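{- If $h:G\to K$ is a skew fibration into a cograph $K$, then every clause of $K$ contains a clause of $h(G)$.
   Context: A graph $(V,E)$: finite $V$, $E$ a set of two-element subsets of $V$; write $vw$. A homomorphism $h:G\to G'$ satisfies $vw\in E(G)\Rightarrow h(v)h(w)\in E(G')$; it is a skew fibration if for every $v\in V(G)$ and every $w$ with $h(v)w\in E(G')$ there is $\hat w$ with $v\hat w\in E(G)$ and $h(\hat w)w\notin E(G')$. A cograph is a graph with nonempty vertex set such that for any distinct $v,w,x,y$ the edges among $\{v,w,x,y\}$ are not exactly $\{vw,wx,xy\}$. $h(G)$ denotes the induced subgraph of $K$ on the vertex set $h(V(G))$. A set of vertices is stable if it contains no edge; a clause is a maximal stable set. -}

module Defs where

open import Data.Nat using (ℕ; _≤_)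
open import Data.Bool using (Bool; true; false)
open import Data.Fin using (Fin)
open import Data.Fin.Subset using (Subset; _∈_; _⊆_)
open import Data.Product using (Σ; ∃; _×_)
open import Relation.Binary.PropositionalEquality using (_≡_; _≢_)
open import Relation.Nullary using (¬_)
open import Data.Unit using (⊤)

record Graph : Set where
  field
    n     : ℕ
    adj   : Fin n → Fin n → Bool
    sym   : ∀ v w → adj v w ≡ adj w v
    irr   : ∀ v → adj v v ≡ false

open Graph public

V : Graph → Set
V G = Fin (n G)

Edge : (G : Graph) → V G → V G → Set
Edge G v w = adj G v w ≡ true

NonEdge : (G : Graph) → V G → V G → Set
NonEdge G v w = adj G v w ≡ false

IsHom : (G K : Graph) → (V G → V K) → Set
IsHom G K h = ∀ v w → Edge G v w → Edge K (h v) (h w)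

IsSkewFibration : (G K : Graph) → (V G → V K) → Set
IsSkewFibration G K h =
  IsHom G K h ×
  (∀ v w → Edge K (h v) w → ∃ λ ŵ → Edge G v ŵ × NonEdge K (h ŵ) w)

-- cograph: nonempty vertex set and no induced P4
IsCograph : Graph → Set
IsCograph K =
  (1 ≤ n K) ×
  (∀ v w x y → v ≢ w → v ≢ x → v ≢ y → w ≢ x → w ≢ y → x ≢ y →
     ¬ (Edge K v w × Edge K w x × Edge K x y ×
        NonEdge K v x × NonEdge K v y × NonEdge K w y))

Stable : (K : Graph) → Subset (n K) → Set
Stable K S = ∀ x y → x ∈ S → y ∈ S → NonEdge K x y

Within : (K : Graph) → (V K → Set) → Subset (n K) → Set
Within K U S = ∀ x → x ∈ S → U x

-- S is a clause (maximal stable set) of the induced subgraph of K on U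
IsClauseIn : (K : Graph) → (V K → Set) → Subset (n K) → Set
IsClauseIn K U S =
  Within K U S × Stable K S ×
  (∀ T → S ⊆ T → Within K U T → Stable K T → T ⊆ S)

AllVertices : (K : Graph) → V K → Set
AllVertices K x = ⊤

IsClause : (K : Graph) → Subset (n K) → Set
IsClause K = IsClauseIn K (AllVertices K)

Image : (G K : Graph) → (V G → V K) → V K → Set
Image G K h x = ∃ λ v → h v ≡ x

{-# OPTIONS --safe #-}
module Submission where

-- Let C be a clause of K and x = h v a vertex of h(G) outside C. By maximality x has a
-- neighbour w ∈ C, and the skew fibration lifts the edge x w to an edge v ŵ with
-- h ŵ ≁ w. If y = h ŵ lies outside C, P₄-freeness of the path w – x – y – z shows that
-- every neighbour z ∈ C of y is a neighbour of x, while w is not a neighbour of y; so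
-- the neighbourhood of y in C is strictly smaller. Descending, we reach a neighbour of
-- x in C ∩ h(G). So C ∩ h(G) is a stable set of h(G) dominating the rest of h(G),
-- i.e. a clause of h(G).

open import Defs
open import Data.Bool using (true)
open import Data.Bool.Properties using (¬-not) renaming (_≟_ to _≟ᵇ_)
open import Data.Fin using (Fin; _≟_)
open import Data.Fin.Properties using (any?)
open import Data.Fin.Subset using (Subset; _∈_; _∉_; _⊆_; _⊂_; _∩_; _∪_; ⁅_⁆; ∣_∣)
open import Data.Fin.Subset.Properties
  using (_∈?_; p⊂q⇒∣p∣<∣q∣; p∩q⊆p; x∈p∩q⁺; x∈p∩q⁻; p⊆p∪q; q⊆p∪q; x∈p∪q⁻; x∈⁅x⁆; x∈⁅y⁆⇒x≡y)
open import Data.Nat using (ℕ; _<_)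
open import Data.Nat.Induction using (<-wellFounded)
open import Data.Product using (∃; _×_; _,_; proj₁; proj₂)
import Data.Product as Product
open import Data.Sum using (_⊎_; inj₁; inj₂; [_,_])
import Data.Sum as Sum
open import Data.Unit using (tt)
open import Data.Vec using (tabulate)
open import Data.Vec.Properties using (lookup∘tabulate; lookup⇒[]=; []=⇒lookup)
open import Function using (_∘_)
open import Induction.WellFounded using (Acc; acc)
open import Level using (Level)
open import Relation.Binary.PropositionalEquality as ≡ using (_≡_; _≢_; refl; trans)
open import Relation.Nullary using (¬_; Dec; yes; no; does; contradiction; _×-dec_)
open import Relation.Nullary.Decidable using (dec-true)
open import Relation.Unary using (Pred; Decidable)

module _ {ℓ : Level} {m : ℕ} {P : Pred (Fin m) ℓ} (P? : Decidable P) where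

  filter : Subset m
  filter = tabulate (does ∘ P?)

  ∈-filter⁺ : ∀ {x} → P x → x ∈ filter
  ∈-filter⁺ {x} px = lookup⇒[]= x filter (trans (lookup∘tabulate (does ∘ P?) x) (dec-true (P? x) px))

  ∈-filter⁻ : ∀ {x} → x ∈ filter → P x
  ∈-filter⁻ {x} x∈ with P? x | trans (≡.sym (lookup∘tabulate (does ∘ P?) x)) ([]=⇒lookup x∈)
  ... | yes px | _ = px
  ... | no _   | ()

module Adjacency (K : Graph) where

  Edge? : ∀ v w → Dec (Edge K v w)
  Edge? v w = adj K v w ≟ᵇ true

  ¬Edge⇒NonEdge : ∀ {v w} → ¬ Edge K v w → NonEdge K v w
  ¬Edge⇒NonEdge = ¬-not

  Edge⇒¬NonEdge : ∀ {v w} → Edge K v w → ¬ NonEdge K v w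
  Edge⇒¬NonEdge v~w v≁w = contradiction (trans (≡.sym v~w) v≁w) λ ()

  Edge-sym : ∀ {v w} → Edge K v w → Edge K w v
  Edge-sym {v} {w} = trans (sym K w v)

  NonEdge-sym : ∀ {v w} → NonEdge K v w → NonEdge K w v
  NonEdge-sym {v} {w} = trans (sym K w v)

  Edge⇒≢ : ∀ {v w} → Edge K v w → v ≢ w
  Edge⇒≢ v~w refl = Edge⇒¬NonEdge v~w (irr K _)

  neighbours : V K → Subset (n K)
  neighbours x = filter (Edge? x)

  clauseIn⇒dominating : ∀ {U C x} → IsClauseIn K U C → U x → x ∉ C → ∃ λ w → w ∈ C × Edge K x w
  clauseIn⇒dominating {U} {C} {x} (C⊆U , stC , maxC) Ux x∉C with any? (λ w → w ∈? C ×-dec Edge? x w)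
  ... | yes found = found
  ... | no none = contradiction (maxC (C ∪ ⁅ x ⁆) (p⊆p∪q _) within stable (q⊆p∪q C _ (x∈⁅x⁆ x))) x∉C
    where
    split : ∀ {w} → w ∈ C ∪ ⁅ x ⁆ → w ∈ C ⊎ w ≡ x
    split = Sum.map₂ (x∈⁅y⁆⇒x≡y x) ∘ x∈p∪q⁻ C ⁅ x ⁆

    x≁C : ∀ {w} → w ∈ C → NonEdge K x w
    x≁C w∈C = ¬Edge⇒NonEdge λ x~w → none (_ , w∈C , x~w)

    within : Within K U (C ∪ ⁅ x ⁆)
    within w w∈ = [ C⊆U w , (λ { refl → Ux }) ] (split w∈)

    stable : Stable K (C ∪ ⁅ x ⁆)
    stable a b a∈ b∈ with split a∈ | split b∈
    ... | inj₁ a∈C | inj₁ b∈C = stC a b a∈C b∈C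
    ... | inj₁ a∈C | inj₂ refl = NonEdge-sym (x≁C a∈C)
    ... | inj₂ refl | inj₁ b∈C = x≁C b∈C
    ... | inj₂ refl | inj₂ refl = irr K x

  -- The six distinctness conditions of an induced P₄ all follow from the (non-)edges.
  cograph-path-chord : IsCograph K → ∀ {w x y z} →
    Edge K w x → Edge K x y → Edge K y z → NonEdge K w y → NonEdge K w z → Edge K x z
  cograph-path-chord (_ , noP₄) {w} {x} {y} {z} w~x x~y y~z w≁y w≁z with Edge? x z
  ... | yes x~z = x~z
  ... | no x≁z = contradiction (w~x , x~y , y~z , w≁y , w≁z , ¬Edge⇒NonEdge x≁z)
    (noP₄ w x y z (Edge⇒≢ w~x) (λ { refl → Edge⇒¬NonEdge y~z w≁z })
          (λ { refl → Edge⇒¬NonEdge y~z (NonEdge-sym w≁y) }) (Edge⇒≢ x~y)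
          (λ { refl → Edge⇒¬NonEdge w~x w≁z }) (Edge⇒≢ y~z))

  ∩-neighbours-⊂ : IsCograph K → ∀ {C} → Stable K C → ∀ {w x y} → w ∈ C →
    Edge K x w → Edge K x y → NonEdge K y w → C ∩ neighbours y ⊂ C ∩ neighbours x
  ∩-neighbours-⊂ cg {C} stC {w} {x} {y} w∈C x~w x~y y≁w = C∩Ny⊆C∩Nx , w , w∈C∩Nx , w∉C∩Ny
    where
    C∩Ny⊆C∩Nx : C ∩ neighbours y ⊆ C ∩ neighbours x
    C∩Ny⊆C∩Nx {z} z∈ with x∈p∩q⁻ C _ z∈
    ... | z∈C , z∈Ny = x∈p∩q⁺ (z∈C , ∈-filter⁺ (Edge? x)
      (cograph-path-chord cg (Edge-sym x~w) x~y (∈-filter⁻ (Edge? y) z∈Ny) (NonEdge-sym y≁w) (stC w z w∈C z∈C)))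

    w∈C∩Nx : w ∈ C ∩ neighbours x
    w∈C∩Nx = x∈p∩q⁺ (w∈C , ∈-filter⁺ (Edge? x) x~w)

    w∉C∩Ny : w ∉ C ∩ neighbours y
    w∉C∩Ny w∈ = Edge⇒¬NonEdge (∈-filter⁻ (Edge? y) (proj₂ (x∈p∩q⁻ C _ w∈))) y≁w

stable-∩⇒clauseIn : (K : Graph) {U : V K → Set} {C : Subset (n K)} (U? : Decidable U) → Stable K C →
  (∀ x → U x → x ∉ C → ∃ λ z → z ∈ C × U z × Edge K x z) → IsClauseIn K U (C ∩ filter U?)
stable-∩⇒clauseIn K {U} {C} U? stC dominated = within , stable , maximal
  where
  open Adjacency K

  ∈S⁺ : ∀ {x} → x ∈ C → U x → x ∈ C ∩ filter U?
  ∈S⁺ x∈C Ux = x∈p∩q⁺ (x∈C , ∈-filter⁺ U? Ux)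

  ∈S⁻ : ∀ {x} → x ∈ C ∩ filter U? → x ∈ C × U x
  ∈S⁻ = Product.map₂ (∈-filter⁻ U?) ∘ x∈p∩q⁻ C _

  within : Within K U (C ∩ filter U?)
  within x = proj₂ ∘ ∈S⁻

  stable : Stable K (C ∩ filter U?)
  stable a b a∈ b∈ = stC a b (proj₁ (∈S⁻ a∈)) (proj₁ (∈S⁻ b∈))

  maximal : ∀ T → C ∩ filter U? ⊆ T → Within K U T → Stable K T → T ⊆ C ∩ filter U?
  maximal T S⊆T T⊆U stT {x} x∈T with x ∈? C
  ... | yes x∈C = ∈S⁺ x∈C (T⊆U x x∈T)
  ... | no x∉C with dominated x (T⊆U x x∈T) x∉C
  ...   | z , z∈C , Uz , x~z = contradiction (stT x z x∈T (S⊆T (∈S⁺ z∈C Uz))) (Edge⇒¬NonEdge x~z)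

Image? : (G K : Graph) (h : V G → V K) → Decidable (Image G K h)
Image? G K h x = any? λ v → h v ≟ x

module _ (G K : Graph) (h : V G → V K) (skew : IsSkewFibration G K h) (cograph : IsCograph K)
         {C : Subset (n K)} (clause : IsClause K C) where

  open Adjacency K

  private
    C-stable : Stable K C
    C-stable = proj₁ (proj₂ clause)

    descend : ∀ v → Acc _<_ ∣ C ∩ neighbours (h v) ∣ → h v ∉ C →
      ∃ λ z → z ∈ C × Image G K h z × Edge K (h v) z
    descend v (acc smaller) hv∉C with clauseIn⇒dominating clause tt hv∉C
    ... | w , w∈C , hv~w with proj₂ skew v w hv~w
    ... | ŵ , v~ŵ , hŵ≁w with h ŵ ∈? C | proj₁ skew v ŵ v~ŵ
    ... | yes hŵ∈C | hv~hŵ = h ŵ , hŵ∈C , (ŵ , refl) , hv~hŵ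
    ... | no hŵ∉C  | hv~hŵ
      with descend ŵ (smaller (p⊂q⇒∣p∣<∣q∣ (∩-neighbours-⊂ cograph C-stable w∈C hv~w hv~hŵ hŵ≁w))) hŵ∉C
    ... | z , z∈C , z∈hG , hŵ~z =
      z , z∈C , z∈hG , cograph-path-chord cograph (Edge-sym hv~w) hv~hŵ hŵ~z (NonEdge-sym hŵ≁w) (C-stable w z w∈C z∈C)

  clause∩image-dominates-image :
    ∀ v → h v ∉ C → ∃ λ z → z ∈ C × Image G K h z × Edge K (h v) z
  clause∩image-dominates-image v = descend v (<-wellFounded _)

lemma4 : (G K : Graph) (h : V G → V K) →
    IsSkewFibration G K h → IsCograph K →
    ∀ C → IsClause K C →
    ∃ λ S → IsClauseIn K (Image G K h) S × S ⊆ C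
lemma4 G K h skew cograph C clause =
  C ∩ filter (Image? G K h) ,
  stable-∩⇒clauseIn K (Image? G K h) (proj₁ (proj₂ clause))
    (λ { x (v , refl) → clause∩image-dominates-image G K h skew cograph clause v }) ,
  p∩q⊆p C _
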